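{- For every positive integer $r$, the circular ladder graph $CL_{2r+1}$ does not admit a $q$-coloured MINI-orientation for any $q\in\mathbb{N}$. Consequently, for $p\geq 2$, no $2p$-regular $(p+2)$-star colourable graph contains $CL_{2r+1}$ as a subgraph.
   Context: $CL_t$ is the Cartesian product $C_t\,\square\,K_2$ (vertices $u_i,v_i$, $i\in\mathbb{Z}_t$, edges $u_iu_{i+1}$, $v_iv_{i+1}$, $u_iv_i$). For an orientation $\vec{G}$ of $G$ and a $q$-colouring $f$ of $G$ (proper colouring with colours $\mathbb{Z}_q$), $(\vec{G},f)$ is a $q$-coloured MINI-orientation if for every vertex $v$: (i) no out-neighbour of $v$ has the same colour as an in-neighbour of $v$; (ii) the out-neighbours of $v$ have pairwise distinct colours; (iii) all in-neighbours of $v$ have the same colour. A $k$-star colouring is a proper colouring with $k$ colours such that the subgraph induced by any two colour classes has every component a star. -}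

module Defs where

open import Data.Nat using (ℕ; zero; suc; _+_; _%_)
open import Data.Fin using (Fin; toℕ)
open import Data.Bool using (Bool)
open import Data.Product using (_×_; Σ; ∃; _,_)
open import Data.Sum using (_⊎_)
open import Data.Empty using (⊥)
open import Data.List using (length; filter)
open import Relation.Nullary using (¬_; Dec)
open import Relation.Binary.PropositionalEquality using (_≡_; _≢_)
import Data.Fin.Base as F
import Data.List.Base as L

record Graph : Set₁ where
  field
    V   : Set
    Adj : V → V → Set
open Graph public

record IsSimple (G : Graph) : Set where
  field
    sym    : ∀ {u v} → Adj G u v → Adj G v u
    irrefl : ∀ {u} → ¬ Adj G u u

record Orientation (G : Graph) : Set₁ where
  field
    Arc     : V G → V G → Set            -- Arc u v : the edge uv is oriented u → v
    arc-adj : ∀ {u v} → Arc u v → Adj G u v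
    cover   : ∀ {u v} → Adj G u v → Arc u v ⊎ Arc v u
    antisym : ∀ {u v} → Arc u v → Arc v u → ⊥
open Orientation public

-- proper colouring with colours Z_q (represented by Fin q)
IsColouring : (G : Graph) (q : ℕ) → (V G → Fin q) → Set
IsColouring G q f = ∀ {u v} → Adj G u v → f u ≢ f v

record IsMINI (G : Graph) (q : ℕ) (O : Orientation G) (f : V G → Fin q) : Set where
  field
    colouring : IsColouring G q f
    cond-i    : ∀ {u v w} → Arc O u v → Arc O v w → f w ≢ f u
    cond-ii   : ∀ {v w w′} → Arc O v w → Arc O v w′ → w ≢ w′ → f w ≢ f w′
    cond-iii  : ∀ {u u′ v} → Arc O u v → Arc O u′ v → f u ≡ f u′

AdmitsMINI : Graph → ℕ → Set₁
AdmitsMINI G q = Σ (Orientation G) λ O → Σ (V G → Fin q) λ f → IsMINI G q O f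

-- Circular ladder CL_t = C_t □ K_2, for t = suc m.
-- Vertices (i , false) = u_i and (i , true) = v_i.

Next : (m : ℕ) → Fin (suc m) → Fin (suc m) → Set
Next m i j = suc (toℕ i) % suc m ≡ toℕ j

CLAdj : (m : ℕ) → Fin (suc m) × Bool → Fin (suc m) × Bool → Set
CLAdj m (i , a) (j , b) =
    (a ≡ b × (Next m i j ⊎ Next m j i))
  ⊎ (i ≡ j × a ≢ b)

CL : ℕ → Graph
CL zero    = record { V = ⊥ ; Adj = λ () }
CL (suc m) = record { V = Fin (suc m) × Bool ; Adj = CLAdj m }

record FinGraph (n : ℕ) : Set₁ where
  field
    adj     : Fin n → Fin n → Set
    adj?    : ∀ u v → Dec (adj u v)
    adj-sym : ∀ {u v} → adj u v → adj v u
    irrefl  : ∀ {u} → ¬ adj u u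

toGraph : ∀ {n} → FinGraph n → Graph
toGraph {n} G = record { V = Fin n ; Adj = FinGraph.adj G }

degree : ∀ {n} → FinGraph n → Fin n → ℕ
degree {n} G v = length (filter (FinGraph.adj? G v) (L.allFin n))

Regular : ∀ {n} → FinGraph n → ℕ → Set
Regular {n} G d = ∀ v → degree G v ≡ d

Subgraph : Graph → Graph → Set
Subgraph H G = Σ (V H → V G) λ φ →
  (∀ {x y} → φ x ≡ φ y → x ≡ y) × (∀ {x y} → Adj H x y → Adj G (φ x) (φ y))

module _ {n k : ℕ} (G : FinGraph n) (f : Fin n → Fin k) (i j : Fin k) where
  open FinGraph G

  InIJ : Fin n → Set
  InIJ x = f x ≡ i ⊎ f x ≡ j

  data Reach (x : Fin n) : Fin n → Set where
    here : InIJ x → Reach x x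
    step : ∀ {y z} → Reach x y → adj y z → InIJ z → Reach x z

  -- every component of G[i,j] is a star: each component contains a vertex c
  -- incident with every edge of the component
  ComponentsAreStars : Set
  ComponentsAreStars = ∀ x → InIJ x →
    ∃ λ c → Reach x c × (∀ y z → Reach x y → adj y z → InIJ z → c ≡ y ⊎ c ≡ z)

IsStarColouring : ∀ {n} → FinGraph n → (k : ℕ) → (Fin n → Fin k) → Set
IsStarColouring G k f =
  IsColouring (toGraph G) k f × (∀ i j → ComponentsAreStars G f i j)

StarColourable : ∀ {n} → FinGraph n → ℕ → Set
StarColourable G k = ∃ λ f → IsStarColouring G k f

{-# OPTIONS --safe #-}
-- In a MINI-orientation, the two rungs of any square of a ladder point in opposite directions:
-- each orientation of the two rails violates (i) or (ii) by way of (iii). So the directions of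
-- the rungs of CL_t properly 2-colour the cycle C_t, which is impossible for t odd.
--
-- Conversely, let f be a (p+2)-star colouring of a 2p-regular graph G and orient vw from v to w
-- when w is the only neighbour of v in the colour of w. Since the bicoloured components are
-- stars, every edge gets at least one direction. The 2p > p+1 neighbours of v use at most p+1
-- colours, so some colour repeats, at most p colours occur exactly once around v, and v has at
-- most p out-arcs; as G has pn edges, double counting forces exactly p out-arcs at every
-- vertex and exactly one direction on every edge. Then exactly one colour occurs repeatedly
-- around v, and it is the colour of every in-neighbour of v. Hence (G, f) is a MINI-orientation,
-- which restricts to subgraphs.
module Submission where

open import Defs
open import Data.Nat using (ℕ; zero; suc; _+_; _*_; _≤_; _<_; z≤n; s≤s; _≤?_; _%_)
open import Data.Bool using (Bool; true; false; not; if_then_else_)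
open import Data.Bool.Properties using (not-involutive; not-¬)
open import Data.Empty using (⊥; ⊥-elim)
open import Data.Fin using (Fin; zero; suc; toℕ) renaming (_≟_ to _≟ᶠ_)
open import Data.Fin.Properties using (any?; toℕ-fromℕ<; toℕ-injective)
open import Data.List using (length; filter; tabulate)
open import Data.Nat.DivMod using (_mod_; n%n≡0; m%n%n≡m%n; %-distribˡ-+)
open import Data.Nat.Properties
open import Algebra.Properties.Semiring.Sum +-*-semiring
  using (sum; sum-syntax; sum-cong-≗; sum-replicate-zero; ∑-distrib-+; ∑-comm; *-distribˡ-sum; *-distribʳ-sum)
open import Data.Product using (_×_; ∃; _,_; proj₁; proj₂)
open import Data.Sum using (_⊎_; inj₁; inj₂; [_,_]′) renaming (map to ⊎-map)
open import Function using (_∘_; const)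
open import Level using (Level)
open import Relation.Nullary using (¬_; Dec; yes; no; does)
open import Relation.Nullary.Decidable using (_×-dec_; ¬?)
open import Relation.Unary using (Pred; Decidable)
open import Relation.Binary.PropositionalEquality

private
  variable
    ℓ : Level
    A : Set ℓ
    P Q : Set ℓ
    m n k : ℕ

-- MINI-orientations

module _ {G : Graph} {q : ℕ} {O : Orientation G} {f : V G → Fin q} (mini : IsMINI G q O f) where
  open IsMINI mini

  -- a b c d is a 4-cycle; each orientation of ab and cd violates (i) or (ii) by (iii).
  no-parallel-opposite-arcs : ∀ {a b c d} → Adj G a b → Adj G c d → b ≢ d → a ≢ c →
                              Arc O a d → Arc O b c → ⊥
  no-parallel-opposite-arcs ab cd b≢d a≢c a→d b→c with cover O ab | cover O cd
  ... | inj₁ a→b | inj₁ c→d = cond-i a→b b→c (cond-iii c→d a→d)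
  ... | inj₁ a→b | inj₂ d→c = cond-ii a→b a→d b≢d (cond-iii b→c d→c)
  ... | inj₂ b→a | inj₁ c→d = cond-ii b→a b→c a≢c (cond-iii a→d c→d)
  ... | inj₂ b→a | inj₂ d→c = cond-i b→a a→d (sym (cond-iii b→c d→c))

subgraph-admitsMINI : ∀ {H G : Graph} {q} → (∀ {x y} → Adj H x y → Adj H y x) →
                      Subgraph H G → AdmitsMINI G q → AdmitsMINI H q
subgraph-admitsMINI {H} H-sym (φ , φ-injective , φ-adj) (O , f , mini) =
  orientation , f ∘ φ , record
    { colouring = λ xy → colouring (φ-adj xy)
    ; cond-i    = λ (_ , x→y) (_ , y→z) → cond-i x→y y→z
    ; cond-ii   = λ (_ , x→y) (_ , x→y′) y≢y′ → cond-ii x→y x→y′ (y≢y′ ∘ φ-injective)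
    ; cond-iii  = λ (_ , x→z) (_ , y→z) → cond-iii x→z y→z
    }
  where
  open IsMINI mini
  orientation : Orientation H
  orientation = record
    { Arc     = λ x y → Adj H x y × Arc O (φ x) (φ y)
    ; arc-adj = proj₁
    ; cover   = λ xy → ⊎-map (xy ,_) (H-sym xy ,_) (cover O (φ-adj xy))
    ; antisym = λ (_ , x→y) (_ , y→x) → antisym O x→y y→x
    }

-- Odd circular ladders

CL-sym : ∀ m {x y} → Adj (CL (suc m)) x y → Adj (CL (suc m)) y x
CL-sym m (inj₁ (a≡b , inj₁ i→j)) = inj₁ (sym a≡b , inj₂ i→j)
CL-sym m (inj₁ (a≡b , inj₂ j→i)) = inj₁ (sym a≡b , inj₁ j→i)
CL-sym m (inj₂ (i≡j , a≢b))      = inj₂ (sym i≡j , a≢b ∘ sym)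

Next-mod : ∀ m k → Next m (k mod suc m) (suc k mod suc m)
Next-mod m k = begin
  suc (toℕ (k mod t)) % t  ≡⟨ cong (λ x → suc x % t) (toℕ-fromℕ< _) ⟩
  suc (k % t) % t          ≡⟨ %-distribˡ-+ 1 (k % t) t ⟩
  (1 % t + k % t % t) % t  ≡⟨ cong (λ x → (1 % t + x) % t) (m%n%n≡m%n k t) ⟩
  (1 % t + k % t) % t      ≡⟨ %-distribˡ-+ 1 k t ⟨
  suc k % t                ≡⟨ toℕ-fromℕ< _ ⟨
  toℕ (suc k mod t)        ∎
  where
  open ≡-Reasoning
  t = suc m

odd-cycle-¬2-colourable : ∀ r (b : Fin (suc (2 * r)) → Bool) →
                          (∀ {i j} → Next (2 * r) i j → b j ≡ not (b i)) → ⊥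
odd-cycle-¬2-colourable r b flips = not-¬ refl (trans (sym c-period) (trans (c-suc (2 * r)) (cong not c-2r)))
  where
  t = suc (2 * r)
  c : ℕ → Bool
  c k = b (k mod t)
  c-suc : ∀ k → c (suc k) ≡ not (c k)
  c-suc k = flips (Next-mod (2 * r) k)
  c-even : ∀ k → c (k + k) ≡ c 0
  c-even zero    = refl
  c-even (suc k) = begin
    c (suc k + suc k)      ≡⟨ cong c (cong suc (+-suc k k)) ⟩
    c (suc (suc (k + k)))  ≡⟨ c-suc (suc (k + k)) ⟩
    not (c (suc (k + k)))  ≡⟨ cong not (c-suc (k + k)) ⟩
    not (not (c (k + k)))  ≡⟨ not-involutive (c (k + k)) ⟩
    c (k + k)              ≡⟨ c-even k ⟩
    c 0                    ∎
    where open ≡-Reasoning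
  c-2r : c (2 * r) ≡ c 0
  c-2r = trans (cong c (cong (r +_) (+-identityʳ r))) (c-even r)
  c-period : c t ≡ c 0
  c-period = cong b (toℕ-injective (trans (toℕ-fromℕ< _) (n%n≡0 t)))

module _ {m q : ℕ} {O : Orientation (CL (suc m))} {f : Fin (suc m) × Bool → Fin q}
         (mini : IsMINI (CL (suc m)) q O f) where

  rung : ∀ i → CLAdj m (i , false) (i , true)
  rung i = inj₂ (refl , λ ())

  rung-up : Fin (suc m) → Bool
  rung-up i = [ const true , const false ]′ (cover O (rung i))

  rung-up-alternates : ∀ {i j} → Next m i j → rung-up j ≡ not (rung-up i)
  rung-up-alternates {i} {j} i→j with cover O (rung i) | cover O (rung j)
  ... | inj₁ uᵢ→vᵢ | inj₁ uⱼ→vⱼ = ⊥-elim (no-parallel-opposite-arcs mini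
          (inj₁ (refl , inj₁ i→j)) (inj₁ (refl , inj₂ i→j)) (λ ()) (λ ()) uᵢ→vᵢ uⱼ→vⱼ)
  ... | inj₁ _     | inj₂ _     = refl
  ... | inj₂ _     | inj₁ _     = refl
  ... | inj₂ vᵢ→uᵢ | inj₂ vⱼ→uⱼ = ⊥-elim (no-parallel-opposite-arcs mini
          (inj₁ (refl , inj₂ i→j)) (inj₁ (refl , inj₁ i→j)) (λ ()) (λ ()) vⱼ→uⱼ vᵢ→uᵢ)

odd-CL-¬admitsMINI : ∀ r q → ¬ AdmitsMINI (CL (suc (2 * r))) q
odd-CL-¬admitsMINI r q (O , f , mini) = odd-cycle-¬2-colourable r (rung-up mini) (rung-up-alternates mini)

-- Counting over finite sets

𝟙 : Dec P → ℕ
𝟙 P? = if does P? then 1 else 0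

𝟙-yes : (P? : Dec P) → P → 𝟙 P? ≡ 1
𝟙-yes (yes _) _ = refl
𝟙-yes (no ¬p) p = ⊥-elim (¬p p)

𝟙-no : (P? : Dec P) → ¬ P → 𝟙 P? ≡ 0
𝟙-no (yes p) ¬p = ⊥-elim (¬p p)
𝟙-no (no _)  _  = refl

𝟙-≤ : ∀ {x} (P? : Dec P) → (P → 1 ≤ x) → 𝟙 P? ≤ x
𝟙-≤ (yes p) 1≤x = 1≤x p
𝟙-≤ (no _)  _   = z≤n

𝟙-cong : (P? : Dec P) (Q? : Dec Q) → (P → Q) → (Q → P) → 𝟙 P? ≡ 𝟙 Q?
𝟙-cong (yes _) (yes _) _   _   = refl
𝟙-cong (yes p) (no ¬q) P→Q _   = ⊥-elim (¬q (P→Q p))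
𝟙-cong (no ¬p) (yes q) _   Q→P = ⊥-elim (¬p (Q→P q))
𝟙-cong (no _)  (no _)  _   _   = refl

𝟙-× : (P? : Dec P) (Q? : Dec Q) → 𝟙 (P? ×-dec Q?) ≡ 𝟙 P? * 𝟙 Q?
𝟙-× (yes _) (yes _) = refl
𝟙-× (yes _) (no _)  = refl
𝟙-× (no _)  (yes _) = refl
𝟙-× (no _)  (no _)  = refl

sum-const : ∀ n c → ∑[ i < n ] c ≡ n * c
sum-const zero    c = refl
sum-const (suc n) c = cong (c +_) (sum-const n c)

sum-mono-≤ : {f g : Fin n → ℕ} → (∀ i → f i ≤ g i) → sum f ≤ sum g
sum-mono-≤ {zero}  _   = z≤n
sum-mono-≤ {suc n} f≤g = +-mono-≤ (f≤g zero) (sum-mono-≤ (f≤g ∘ suc))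

≤-sum : (f : Fin n → ℕ) (i : Fin n) → f i ≤ sum f
≤-sum f zero    = m≤m+n _ _
≤-sum f (suc i) = ≤-trans (≤-sum (f ∘ suc) i) (m≤n+m _ _)

+-≤-sum : (f : Fin n → ℕ) {i j : Fin n} → i ≢ j → f i + f j ≤ sum f
+-≤-sum f {zero}  {zero}  i≢j = ⊥-elim (i≢j refl)
+-≤-sum f {zero}  {suc j} _   = +-monoʳ-≤ (f zero) (≤-sum (f ∘ suc) j)
+-≤-sum f {suc i} {zero}  _   = subst (_≤ sum f) (+-comm (f zero) (f (suc i)))
                                  (+-monoʳ-≤ (f zero) (≤-sum (f ∘ suc) i))
+-≤-sum f {suc i} {suc j} i≢j = ≤-trans (+-≤-sum (f ∘ suc) (i≢j ∘ cong suc)) (m≤n+m _ _)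

≤-pointwise∧sum-≥⇒≡ : {f g : Fin n → ℕ} → (∀ i → f i ≤ g i) → sum g ≤ sum f → ∀ i → f i ≡ g i
≤-pointwise∧sum-≥⇒≡ {suc n} {f} {g} f≤g Σg≤Σf = λ where
    zero    → ≤-antisym (f≤g zero) g₀≤f₀
    (suc i) → ≤-pointwise∧sum-≥⇒≡ (f≤g ∘ suc) Σg′≤Σf′ i
  where
  Σf′≤Σg′ : sum (f ∘ suc) ≤ sum (g ∘ suc)
  Σf′≤Σg′ = sum-mono-≤ (f≤g ∘ suc)
  g₀≤f₀ : g zero ≤ f zero
  g₀≤f₀ = +-cancelʳ-≤ _ _ _ (≤-trans Σg≤Σf (+-monoʳ-≤ (f zero) Σf′≤Σg′))
  Σg′≤Σf′ : sum (g ∘ suc) ≤ sum (f ∘ suc)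
  Σg′≤Σf′ = +-cancelˡ-≤ (g zero) _ _ (≤-trans Σg≤Σf (+-monoˡ-≤ _ (f≤g zero)))

sum-δ : (x : Fin n) (g : Fin n → ℕ) → ∑[ c < n ] (𝟙 (x ≟ᶠ c) * g c) ≡ g x
sum-δ {suc n} zero g = trans (cong₂ _+_ (+-identityʳ (g zero)) (sum-replicate-zero n)) (+-identityʳ (g zero))
sum-δ (suc x) g = sum-δ x (g ∘ suc)

count : {P : Pred (Fin n) ℓ} → Decidable P → ℕ
count {n = n} P? = ∑[ i < n ] 𝟙 (P? i)

count-≥1 : {P : Pred (Fin n) ℓ} (P? : Decidable P) {i : Fin n} → P i → 1 ≤ count P?
count-≥1 P? {i} Pi = subst (_≤ count P?) (𝟙-yes (P? i) Pi) (≤-sum _ i)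

count-≥2 : {P : Pred (Fin n) ℓ} (P? : Decidable P) {i j : Fin n} → i ≢ j → P i → P j → 2 ≤ count P?
count-≥2 P? {i} {j} i≢j Pi Pj =
  subst (_≤ count P?) (cong₂ _+_ (𝟙-yes (P? i) Pi) (𝟙-yes (P? j) Pj)) (+-≤-sum _ i≢j)

count-≡ : (x : Fin n) → count (x ≟ᶠ_) ≡ 1
count-≡ x = trans (sum-cong-≗ (λ c → sym (*-identityʳ (𝟙 (x ≟ᶠ c))))) (sum-δ x (const 1))

count≢1⇒another : {P : Pred (Fin n) ℓ} (P? : Decidable P) {x : Fin n} → P x → count P? ≢ 1 →
                  ∃ λ y → y ≢ x × P y
count≢1⇒another {P = P} P? {x} Px count≢1 with any? (λ y → ¬? (y ≟ᶠ x) ×-dec P? y)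
... | yes another = another
... | no ∄another = ⊥-elim (count≢1 (trans (sum-cong-≗ count-as-≡) (count-≡ x)))
  where
  only-x : ∀ {y} → P y → x ≡ y
  only-x {y} Py with y ≟ᶠ x
  ... | yes y≡x = sym y≡x
  ... | no y≢x  = ⊥-elim (∄another (y , y≢x , Py))
  count-as-≡ : ∀ y → 𝟙 (P? y) ≡ 𝟙 (x ≟ᶠ y)
  count-as-≡ y = 𝟙-cong (P? y) (x ≟ᶠ y) only-x (λ x≡y → subst P x≡y Px)

length-filter-tabulate : {P : Pred A ℓ} (P? : Decidable P) (g : Fin n → A) →
                         length (filter P? (tabulate g)) ≡ ∑[ i < n ] 𝟙 (P? (g i))
length-filter-tabulate {n = zero}  P? g = refl
length-filter-tabulate {n = suc n} P? g with P? (g zero)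
... | yes _ = cong suc (length-filter-tabulate P? (g ∘ suc))
... | no _  = length-filter-tabulate P? (g ∘ suc)

count-by-fibres : {P : Pred (Fin m) ℓ} (P? : Decidable P) (f : Fin m → Fin k) (g : Fin k → ℕ) →
                  ∑[ i < m ] (𝟙 (P? i) * g (f i)) ≡ ∑[ c < k ] (count (λ i → P? i ×-dec (f i ≟ᶠ c)) * g c)
count-by-fibres {m = m} {k = k} P? f g = begin
  ∑[ i < m ] (𝟙 (P? i) * g (f i))
    ≡⟨ sum-cong-≗ (λ i → cong (𝟙 (P? i) *_) (sum-δ (f i) g)) ⟨
  ∑[ i < m ] (𝟙 (P? i) * ∑[ c < k ] (𝟙 (f i ≟ᶠ c) * g c))
    ≡⟨ sum-cong-≗ (λ i → *-distribˡ-sum (𝟙 (P? i)) (λ c → 𝟙 (f i ≟ᶠ c) * g c)) ⟩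
  ∑[ i < m ] ∑[ c < k ] (𝟙 (P? i) * (𝟙 (f i ≟ᶠ c) * g c))
    ≡⟨ ∑-comm (λ i c → 𝟙 (P? i) * (𝟙 (f i ≟ᶠ c) * g c)) ⟩
  ∑[ c < k ] ∑[ i < m ] (𝟙 (P? i) * (𝟙 (f i ≟ᶠ c) * g c))
    ≡⟨ sum-cong-≗ (λ c → sum-cong-≗ (λ i → trans (cong (_* g c) (𝟙-× (P? i) (f i ≟ᶠ c))) (*-assoc (𝟙 (P? i)) (𝟙 (f i ≟ᶠ c)) (g c)))) ⟨
  ∑[ c < k ] ∑[ i < m ] (𝟙 (P? i ×-dec (f i ≟ᶠ c)) * g c)
    ≡⟨ sum-cong-≗ (λ c → *-distribʳ-sum (g c) (λ i → 𝟙 (P? i ×-dec (f i ≟ᶠ c)))) ⟨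
  ∑[ c < k ] (count (λ i → P? i ×-dec (f i ≟ᶠ c)) * g c)
    ∎
  where open ≡-Reasoning

-- Colour profiles and a tight handshake count

module _ (a : Fin k → ℕ) where

  zeros ones bigs : ℕ
  zeros = count (λ c → a c ≟ 0)
  ones  = count (λ c → a c ≟ 1)
  bigs  = count (λ c → 2 ≤? a c)

  profile-partition : zeros + ones + bigs ≡ k
  profile-partition = begin
    zeros + ones + bigs              ≡⟨ cong (_+ bigs) (∑-distrib-+ z o) ⟨
    ∑[ c < k ] (z c + o c) + bigs    ≡⟨ ∑-distrib-+ (λ c → z c + o c) b ⟨
    ∑[ c < k ] (z c + o c + b c)     ≡⟨ sum-cong-≗ (λ c → exactly-one (a c)) ⟩
    ∑[ c < k ] 1                     ≡⟨ sum-const k 1 ⟩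
    k * 1                            ≡⟨ *-identityʳ k ⟩
    k                                ∎
    where
    open ≡-Reasoning
    z o b : Fin k → ℕ
    z c = 𝟙 (a c ≟ 0)
    o c = 𝟙 (a c ≟ 1)
    b c = 𝟙 (2 ≤? a c)
    exactly-one : ∀ x → 𝟙 (x ≟ 0) + 𝟙 (x ≟ 1) + 𝟙 (2 ≤? x) ≡ 1
    exactly-one zero          = refl
    exactly-one (suc zero)    = refl
    exactly-one (suc (suc x)) = refl

  module _ {z : Fin k} (a-z≡0 : a z ≡ 0) where

    ones+bigs<k : ones + bigs < k
    ones+bigs<k = ≤-trans (+-monoˡ-≤ (ones + bigs) (count-≥1 (λ c → a c ≟ 0) a-z≡0))
                          (≤-reflexive (trans (sym (+-assoc zeros ones bigs)) profile-partition))

    big-exists : k ≤ sum a → ∃ λ c → 2 ≤ a c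
    big-exists k≤Σa with any? (λ c → 2 ≤? a c)
    ... | yes big = big
    ... | no ∄big = ⊥-elim (<⇒≱ (≤-<-trans Σa≤ones (≤-<-trans (m≤m+n ones bigs) ones+bigs<k)) k≤Σa)
      where
      ≤-𝟙[≡1] : ∀ x → ¬ 2 ≤ x → x ≤ 𝟙 (x ≟ 1)
      ≤-𝟙[≡1] zero          _    = z≤n
      ≤-𝟙[≡1] (suc zero)    _    = ≤-refl
      ≤-𝟙[≡1] (suc (suc x)) ¬big = ⊥-elim (¬big (s≤s (s≤s z≤n)))
      Σa≤ones : sum a ≤ ones
      Σa≤ones = sum-mono-≤ (λ c → ≤-𝟙[≡1] (a c) (λ big → ∄big (c , big)))

    ones+2≤k : k ≤ sum a → ones + 2 ≤ k
    ones+2≤k k≤Σa = begin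
      ones + 2            ≡⟨ +-suc ones 1 ⟩
      suc (ones + 1)      ≤⟨ s≤s (+-monoʳ-≤ ones (count-≥1 (λ c → 2 ≤? a c) (proj₂ (big-exists k≤Σa)))) ⟩
      suc (ones + bigs)   ≤⟨ ones+bigs<k ⟩
      k                   ∎
      where open ≤-Reasoning

    big-unique : ones + 2 ≡ k → ∀ {c₁ c₂} → 2 ≤ a c₁ → 2 ≤ a c₂ → c₁ ≡ c₂
    big-unique ones+2≡k {c₁} {c₂} big₁ big₂ with c₁ ≟ᶠ c₂
    ... | yes c₁≡c₂ = c₁≡c₂
    ... | no c₁≢c₂  = ⊥-elim (<-irrefl refl
                        (≤-<-trans ones+2≤ones+bigs (subst (ones + bigs <_) (sym ones+2≡k) ones+bigs<k)))
      where
      ones+2≤ones+bigs : ones + 2 ≤ ones + bigs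
      ones+2≤ones+bigs = +-monoʳ-≤ ones (count-≥2 (λ c → 2 ≤? a c) c₁≢c₂ big₁ big₂)

handshake-tight : ∀ d (e l : Fin n → Fin n → ℕ) →
                  (∀ v w → e v w ≤ l v w + l w v) →
                  (∀ v → ∑[ w < n ] e v w ≡ d + d) →
                  (∀ v → ∑[ w < n ] l v w ≤ d) →
                  (∀ v → ∑[ w < n ] l v w ≡ d) × (∀ v w → e v w ≡ l v w + l w v)
handshake-tight {n} d e l covered degree out≤d = out≡d , edge≡
  where
  out : Fin n → ℕ
  out v = ∑[ w < n ] l v w
  both : Fin n → Fin n → ℕ
  both v w = l v w + l w v
  D S : ℕ
  D = ∑[ v < n ] d
  S = sum out
  ΣΣe≡D+D : ∑[ v < n ] ∑[ w < n ] e v w ≡ D + D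
  ΣΣe≡D+D = trans (sum-cong-≗ degree) (∑-distrib-+ {n} (const d) (const d))
  ΣΣboth≡S+S : ∑[ v < n ] ∑[ w < n ] both v w ≡ S + S
  ΣΣboth≡S+S = begin
    ∑[ v < n ] ∑[ w < n ] both v w                  ≡⟨ sum-cong-≗ (λ v → ∑-distrib-+ (l v) (λ w → l w v)) ⟩
    ∑[ v < n ] (out v + ∑[ w < n ] l w v)           ≡⟨ ∑-distrib-+ out (λ v → ∑[ w < n ] l w v) ⟩
    S + ∑[ v < n ] ∑[ w < n ] l w v                 ≡⟨ cong (S +_) (∑-comm (λ v w → l w v)) ⟩
    S + S                                           ∎
    where open ≡-Reasoning
  S≤D : S ≤ D
  S≤D = sum-mono-≤ out≤d
  D≤S : D ≤ S
  D≤S = +-cancelʳ-≤ D D S (begin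
    D + D                                ≡⟨ ΣΣe≡D+D ⟨
    ∑[ v < n ] ∑[ w < n ] e v w          ≤⟨ sum-mono-≤ (λ v → sum-mono-≤ (covered v)) ⟩
    ∑[ v < n ] ∑[ w < n ] both v w       ≡⟨ ΣΣboth≡S+S ⟩
    S + S                                ≤⟨ +-monoʳ-≤ S S≤D ⟩
    S + D                                ∎)
    where open ≤-Reasoning
  out≡d : ∀ v → out v ≡ d
  out≡d = ≤-pointwise∧sum-≥⇒≡ out≤d D≤S
  S≡D : S ≡ D
  S≡D = ≤-antisym S≤D D≤S
  row≡ : ∀ v → ∑[ w < n ] e v w ≡ ∑[ w < n ] both v w
  row≡ = ≤-pointwise∧sum-≥⇒≡ (λ v → sum-mono-≤ (covered v))
           (≤-reflexive (trans ΣΣboth≡S+S (trans (cong₂ _+_ S≡D S≡D) (sym ΣΣe≡D+D))))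
  edge≡ : ∀ v w → e v w ≡ both v w
  edge≡ v = ≤-pointwise∧sum-≥⇒≡ (covered v) (≤-reflexive (sym (row≡ v)))

-- Star colourings

degree≡count : (G : FinGraph n) (v : Fin n) → degree G v ≡ count (FinGraph.adj? G v)
degree≡count G v = length-filter-tabulate (FinGraph.adj? G v) (λ w → w)

module StarColoured {n k : ℕ} (G : FinGraph n) (f : Fin n → Fin k)
                    (star : IsStarColouring G k f) where
  open FinGraph G

  proper : IsColouring (toGraph G) k f
  proper = proj₁ star

  N : Fin n → Fin k → ℕ
  N v c = count (λ w → adj? v w ×-dec (f w ≟ᶠ c))

  -- v is a leaf of the bicoloured star containing the edge vw (or vw is a whole component).
  Leaf : Fin n → Fin n → Set
  Leaf v w = N v (f w) ≡ 1

  leaf? : ∀ v w → Dec (Leaf v w)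
  leaf? v w = N v (f w) ≟ 1

  LeafArc : Fin n → Fin n → Set
  LeafArc v w = adj v w × Leaf v w

  arc? : ∀ v w → Dec (LeafArc v w)
  arc? v w = adj? v w ×-dec leaf? v w

  outdeg : Fin n → ℕ
  outdeg v = count (arc? v)

  N-own : ∀ v → N v (f v) ≡ 0
  N-own v = trans (sum-cong-≗ (λ w → 𝟙-no (adj? v w ×-dec (f w ≟ᶠ f v)) (λ (vw , fw≡fv) → proper vw (sym fw≡fv))))
                  (sum-replicate-zero n)

  ∑N≡count-adj : ∀ v → sum (N v) ≡ count (adj? v)
  ∑N≡count-adj v = begin
    ∑[ c < k ] N v c                     ≡⟨ sum-cong-≗ (λ c → *-identityʳ (N v c)) ⟨
    ∑[ c < k ] (N v c * 1)               ≡⟨ count-by-fibres (adj? v) f (const 1) ⟨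
    ∑[ w < n ] (𝟙 (adj? v w) * 1)        ≡⟨ sum-cong-≗ (λ w → *-identityʳ (𝟙 (adj? v w))) ⟩
    count (adj? v)                       ∎
    where open ≡-Reasoning

  outdeg≡ones : ∀ v → outdeg v ≡ ones (N v)
  outdeg≡ones v = begin
    outdeg v                                    ≡⟨ sum-cong-≗ (λ w → 𝟙-× (adj? v w) (leaf? v w)) ⟩
    ∑[ w < n ] (𝟙 (adj? v w) * g (f w))         ≡⟨ count-by-fibres (adj? v) f g ⟩
    ∑[ c < k ] (N v c * g c)                    ≡⟨ sum-cong-≗ (λ c → n*𝟙[n≡1]≡𝟙[n≡1] (N v c)) ⟩
    ones (N v)                                  ∎
    where
    open ≡-Reasoning
    g : Fin k → ℕ
    g c = 𝟙 (N v c ≟ 1)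
    n*𝟙[n≡1]≡𝟙[n≡1] : ∀ x → x * 𝟙 (x ≟ 1) ≡ 𝟙 (x ≟ 1)
    n*𝟙[n≡1]≡𝟙[n≡1] zero          = refl
    n*𝟙[n≡1]≡𝟙[n≡1] (suc zero)    = refl
    n*𝟙[n≡1]≡𝟙[n≡1] (suc (suc x)) = *-zeroʳ (suc (suc x))

  -- v and w would each have a second neighbour in the other's colour, so the centre of the
  -- bicoloured star through vw could be neither v nor w.
  ¬two-inner-ends : ∀ {v w} → adj v w → ¬ Leaf v w → ¬ Leaf w v → ⊥
  ¬two-inner-ends {v} {w} vw ¬Lvw ¬Lwv
    with count≢1⇒another (λ u → adj? v u ×-dec (f u ≟ᶠ f w)) (vw , refl) ¬Lvw
       | count≢1⇒another (λ u → adj? w u ×-dec (f u ≟ᶠ f v)) (adj-sym vw , refl) ¬Lwv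
       | proj₂ star (f v) (f w) v (inj₁ refl)
  ... | w′ , w′≢w , vw′ , fw′≡fw | v′ , v′≢v , wv′ , fv′≡fv | c , _ , incident
    with incident v w (here (inj₁ refl)) vw (inj₂ refl)
  ... | inj₁ c≡v = [ (λ c≡w → irrefl (subst (adj v) (trans (sym c≡w) c≡v) vw))
                   , (λ c≡v′ → v′≢v (trans (sym c≡v′) c≡v)) ]′
                   (incident w v′ (step (here (inj₁ refl)) vw (inj₂ refl)) wv′ (inj₁ fv′≡fv))
  ... | inj₂ c≡w = [ (λ c≡v → irrefl (subst (adj v) (trans (sym c≡w) c≡v) vw))
                   , (λ c≡w′ → w′≢w (trans (sym c≡w′) c≡w)) ]′
                   (incident v w′ (here (inj₁ refl)) vw′ (inj₂ fw′≡fw))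

  leaf-end : ∀ {v w} → adj v w → Leaf v w ⊎ Leaf w v
  leaf-end {v} {w} vw with leaf? v w | leaf? w v
  ... | yes Lvw | _       = inj₁ Lvw
  ... | no _    | yes Lwv = inj₂ Lwv
  ... | no ¬Lvw | no ¬Lwv = ⊥-elim (¬two-inner-ends vw ¬Lvw ¬Lwv)

module RegularStarColoured {n p : ℕ} (G : FinGraph n) (p≥2 : 2 ≤ p) (regular : Regular G (2 * p))
                           (f : Fin n → Fin (p + 2)) (star : IsStarColouring G (p + 2) f) where
  open FinGraph G
  open StarColoured G f star

  count-adj≡p+p : ∀ v → count (adj? v) ≡ p + p
  count-adj≡p+p v = trans (sym (degree≡count G v)) (trans (regular v) (cong (p +_) (+-identityʳ p)))

  p+2≤∑N : ∀ v → p + 2 ≤ sum (N v)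
  p+2≤∑N v = ≤-trans (+-monoʳ-≤ p p≥2) (≤-reflexive (sym (trans (∑N≡count-adj v) (count-adj≡p+p v))))

  outdeg≤p : ∀ v → outdeg v ≤ p
  outdeg≤p v = +-cancelʳ-≤ 2 (outdeg v) p
    (subst (λ o → o + 2 ≤ p + 2) (sym (outdeg≡ones v)) (ones+2≤k (N v) (N-own v) (p+2≤∑N v)))

  edge-covered : ∀ v w → 𝟙 (adj? v w) ≤ 𝟙 (arc? v w) + 𝟙 (arc? w v)
  edge-covered v w = 𝟙-≤ (adj? v w) λ vw →
    [ (λ Lvw → ≤-trans (≤-reflexive (sym (𝟙-yes (arc? v w) (vw , Lvw)))) (m≤m+n _ _))
    , (λ Lwv → ≤-trans (≤-reflexive (sym (𝟙-yes (arc? w v) (adj-sym vw , Lwv)))) (m≤n+m _ _)) ]′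
    (leaf-end vw)

  tight : (∀ v → outdeg v ≡ p) × (∀ v w → 𝟙 (adj? v w) ≡ 𝟙 (arc? v w) + 𝟙 (arc? w v))
  tight = handshake-tight p (λ v w → 𝟙 (adj? v w)) (λ v w → 𝟙 (arc? v w)) edge-covered count-adj≡p+p outdeg≤p

  outdeg≡p : ∀ v → outdeg v ≡ p
  outdeg≡p = proj₁ tight

  arc-antisym : ∀ {v w} → LeafArc v w → LeafArc w v → ⊥
  arc-antisym {v} {w} (vw , Lvw) (wv , Lwv) = 1+n≢n (begin
    2                                  ≡⟨ cong₂ _+_ (𝟙-yes (arc? v w) (vw , Lvw)) (𝟙-yes (arc? w v) (wv , Lwv)) ⟨
    𝟙 (arc? v w) + 𝟙 (arc? w v)        ≡⟨ proj₂ tight v w ⟨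
    𝟙 (adj? v w)                       ≡⟨ 𝟙-yes (adj? v w) vw ⟩
    1                                  ∎)
    where open ≡-Reasoning

  orientation : Orientation (toGraph G)
  orientation = record
    { Arc     = LeafArc
    ; arc-adj = proj₁
    ; cover   = λ vw → ⊎-map (vw ,_) (adj-sym vw ,_) (leaf-end vw)
    ; antisym = arc-antisym
    }

  in-colour-big : ∀ {u v} → LeafArc u v → 2 ≤ N v (f u)
  in-colour-big {u} {v} (uv , Luv) =
    ≤∧≢⇒< (count-≥1 (λ w → adj? v w ×-dec (f w ≟ᶠ f u)) (adj-sym uv , refl))
          (λ 1≡N → arc-antisym (uv , Luv) (adj-sym uv , sym 1≡N))

  mini : IsMINI (toGraph G) (p + 2) orientation f
  mini = record
    { colouring = proper
    ; cond-i    = λ {u} {v} (uv , Luv) (_ , Lvw) fw≡fu →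
                    arc-antisym (uv , Luv) (adj-sym uv , subst (λ c → N v c ≡ 1) fw≡fu Lvw)
    ; cond-ii   = λ {v} {w} (vw , Lvw) (vw′ , _) w≢w′ fw≡fw′ →
                    <-irrefl refl (subst (2 ≤_) Lvw
                      (count-≥2 (λ u → adj? v u ×-dec (f u ≟ᶠ f w)) w≢w′ (vw , refl) (vw′ , sym fw≡fw′)))
    ; cond-iii  = λ {_} {_} {v} u→v u′→v →
                    big-unique (N v) (N-own v) (cong (_+ 2) (trans (sym (outdeg≡ones v)) (outdeg≡p v)))
                      (in-colour-big u→v) (in-colour-big u′→v)
    }

  admitsMINI : AdmitsMINI (toGraph G) (p + 2)
  admitsMINI = orientation , f , mini

theorem17 : (∀ (r : ℕ) → 1 ≤ r → ∀ (q : ℕ) → ¬ AdmitsMINI (CL (suc (2 * r))) q)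
            × (∀ (p : ℕ) → 2 ≤ p → ∀ (r : ℕ) → 1 ≤ r → ∀ (n : ℕ) (G : FinGraph n) →
                 Regular G (2 * p) → StarColourable G (p + 2) →
                 ¬ Subgraph (CL (suc (2 * r))) (toGraph G))
theorem17 = (λ r _ → odd-CL-¬admitsMINI r) , λ p p≥2 r _ n G regular (f , star) CL⊆G →
  odd-CL-¬admitsMINI r (p + 2)
    (subgraph-admitsMINI (CL-sym (2 * r)) CL⊆G (RegularStarColoured.admitsMINI G p≥2 regular f star))
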